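{- Let $w$ be a $k\times \ell$ partial permutation matrix and let $c(w)\in S_m$ be its completion. Then extension via elbow tiles (viewing a pipe dream on the $k\times\ell$ grid as a pipe dream on the $m\times m$ grid with the same cross tiles and elbow tiles in all positions $(i,j)$ with $i>k$ or $j>\ell$) gives bijections $$\mathrm{RPipes}(w)\to \mathrm{RPipes}(c(w)),\qquad \mathrm{Pipes}(w)\to\mathrm{Pipes}(c(w)).$$ Moreover, if $m'\ge m$ and $v\in S_{m'}$ is $c(w)$ extended by the identity (i.e. $v(i)=c(w)(i)$ for $i\le m$ and $v(i)=i$ for $m<i\le m'$), then extension via elbow tiles likewise gives bijections $\mathrm{RPipes}(w)\to\mathrm{RPipes}(v)$ and $\mathrm{Pipes}(w)\to\mathrm{Pipes}(v)$.
   Context: A permutation $v\in S_m$ is identified with the $m\times m$ permutation matrix having a $1$ in entry $(i,v(i))$; $\tau_i$ is the simple transposition of $i,i+1$ and $\ell(v)$ the length. A $k\times\ell$ partial permutation matrix is a $0/1$ matrix with at most one $1$ in each row and each column. Its completion $c(w)$ is the permutation matrix of smallest possible size, and of minimal length among those, having $w$ as its northwest $k\times\ell$ submatrix; it is also regarded as an element of $S_{k+\ell}$ by letting it fix all larger integers. A pipe dream on a $k\times\ell$ grid is a subset $P\subseteq\{1,\dots,k\}\times\{1,\dots,\ell\}$ (cross tiles at the elements of $P$, elbow tiles elsewhere); $|P|$ is its number of crosses. Its Demazure product $\delta(P)\in S_{k+\ell}$ is the evaluation of the word $\tau_{i_1+j_1-1}\cdots\tau_{i_r+j_r-1}$, where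 $(i_1,j_1),\dots,(i_r,j_r)$ are the crosses read along each row from right to left, rows from top to bottom, subject to the relations $\tau_i^2=\tau_i$, $\tau_i\tau_{i+1}\tau_i=\tau_{i+1}\tau_i\tau_{i+1}$, $\tau_i\tau_j=\tau_j\tau_i$ for $|i-j|\ge2$ (the 0-Hecke monoid, whose elements are identified with permutations). For $v\in S_m$, $\mathrm{Pipes}(v)$ is the set of pipe dreams $P$ on the $m\times m$ grid with $\delta(P)=v$ and $\mathrm{RPipes}(v)$ the subset with $|P|=\ell(v)$ (reduced pipe dreams). For a $k\times\ell$ partial permutation matrix $w$, $\mathrm{Pipes}(w)$ is the set of pipe dreams $P$ on the $k\times\ell$ grid with $\delta(P)=c(w)$, and $\mathrm{RPipes}(w)$ is the subset of reduced ones ($|P|=\ell(c(w))$). -}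

module Defs where

open import Data.Nat using (ℕ; zero; suc; _+_; _≤_; _<_; _<ᵇ_; _≡ᵇ_)
open import Data.Bool using (Bool; true; false; if_then_else_; _∧_)
open import Data.Fin using (Fin; toℕ) renaming (zero to fzero; suc to fsuc)
open import Data.List using (List; []; _∷_; map; concatMap; reverse; foldl; upTo; allFin)
open import Data.Nat.ListAction using (sum)
open import Data.Maybe using (Maybe; just; nothing)
import Data.Maybe as Maybe
open import Data.Product using (Σ; _×_)
open import Relation.Binary.PropositionalEquality using (_≡_)
open import Function.Bundles using (_⇔_)

-- Conventions: everything is 0-indexed.  Row/column (i , j) here corresponds to
-- row/column (i+1 , j+1) in the paper; the paper's τ_p (swapping p and p+1)
-- is  swapAt (p ∸ 1)  here.

IsPerm : ℕ → (ℕ → ℕ) → Set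
IsPerm m v = (∀ i → m ≤ i → v i ≡ i)
           × (∀ i → i < m → v i < m)
           × (∀ i j → i < m → j < m → v i ≡ v j → i ≡ j)

_≗ₚ_ : (ℕ → ℕ) → (ℕ → ℕ) → Set
u ≗ₚ v = ∀ i → u i ≡ v i

inv : ℕ → (ℕ → ℕ) → ℕ
inv m v = sum (map (λ i → sum (map (λ j → if (i <ᵇ j) ∧ (v j <ᵇ v i) then 1 else 0) (upTo m))) (upTo m))

-- 0/1 matrices (and pipe dreams = sets of crosses) on a k × l grid.
Grid : ℕ → ℕ → Set
Grid k l = Fin k → Fin l → Bool

_≗ᵍ_ : ∀ {k l} → Grid k l → Grid k l → Set
P ≗ᵍ Q = ∀ i j → P i j ≡ Q i j

IsPPM : ∀ {k l} → Grid k l → Set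
IsPPM {k} {l} w = (∀ i j j′ → w i j ≡ true → w i j′ ≡ true → j ≡ j′)
                × (∀ i i′ j → w i j ≡ true → w i′ j ≡ true → i ≡ i′)

HasNW : ∀ {k l} → Grid k l → ℕ → (ℕ → ℕ) → Set
HasNW {k} {l} w m v = k ≤ m × l ≤ m
                    × (∀ (i : Fin k) (j : Fin l) → (w i j ≡ true) ⇔ (v (toℕ i) ≡ toℕ j))

IsCompletion : ∀ {k l} → Grid k l → ℕ → (ℕ → ℕ) → Set
IsCompletion w m c = IsPerm m c × HasNW w m c
                   × (∀ m′ u → IsPerm m′ u → HasNW w m′ u → m ≤ m′)
                   × (∀ u → IsPerm m u → HasNW w m u → inv m c ≤ inv m u)

crosses : ∀ {k l} → Grid k l → ℕ
crosses {k} {l} P = sum (map (λ i → sum (map (λ j → if P i j then 1 else 0) (allFin l))) (allFin k))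

swapAt : ℕ → ℕ → ℕ
swapAt p x = if x ≡ᵇ p then suc p else (if x ≡ᵇ suc p then p else x)

-- right multiplication by a generator in the 0-Hecke monoid (Demazure product),
-- permutations composed as functions: u · τ = u ∘ τ if that increases length, else u.
demStep : (ℕ → ℕ) → ℕ → (ℕ → ℕ)
demStep u p = if u p <ᵇ u (suc p) then (λ x → u (swapAt p x)) else u

word : ∀ {k l} → Grid k l → List ℕ
word {k} {l} P = concatMap (λ i → concatMap (λ j → if P i j then (toℕ i + toℕ j) ∷ [] else [])
                                             (reverse (allFin l)))
                           (allFin k)

δ : ∀ {k l} → Grid k l → (ℕ → ℕ)
δ P = foldl demStep (λ x → x) (word P)

Pipes : (m : ℕ) → (ℕ → ℕ) → Grid m m → Set
Pipes m v P = δ P ≗ₚ v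

RPipes : (m : ℕ) → (ℕ → ℕ) → Grid m m → Set
RPipes m v P = δ P ≗ₚ v × crosses P ≡ inv m v

PipesW : ∀ {k l} → Grid k l → ℕ → (ℕ → ℕ) → Grid k l → Set
PipesW w m c P = δ P ≗ₚ c

RPipesW : ∀ {k l} → Grid k l → ℕ → (ℕ → ℕ) → Grid k l → Set
RPipesW w m c P = δ P ≗ₚ c × crosses P ≡ inv m c

toFin? : (n : ℕ) → ℕ → Maybe (Fin n)
toFin? zero    _       = nothing
toFin? (suc n) zero    = just fzero
toFin? (suc n) (suc i) = Maybe.map fsuc (toFin? n i)

entry : ∀ {k l} → Grid k l → ℕ → ℕ → Bool
entry {k} {l} P i j with toFin? k i | toFin? l j
... | just a | just b = P a b
... | _      | _      = false

ext : ∀ {k l} (m : ℕ) → Grid k l → Grid m m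
ext m P i j = entry P (toℕ i) (toℕ j)

ExtBij : ∀ {k l} (m : ℕ) → (Grid k l → Set) → (Grid m m → Set) → Set
ExtBij {k} {l} m A B =
    (∀ P → A P → B (ext m P))
  × (∀ P Q → A P → A Q → ext m P ≗ᵍ ext m Q → P ≗ᵍ Q)
  × (∀ Q → B Q → Σ (Grid k l) (λ P → A P × ext m P ≗ᵍ Q))

-- Minimality of ℓ(c) gives two rigidity properties: c has an ascent at every p ≥ k (otherwise
-- c ∘ τ_p is shorter and still has w as northwest block), and c⁻¹ has an ascent at every q ≥ l
-- (otherwise τ_q ∘ c).  A Demazure product never has an ascent at the last letter of its word,
-- and a cross in row i makes that last letter at least i; so a pipe dream for c has no cross in
-- a row ≥ k.  The topmost cross (i, j) of the rightmost occupied column is preceded in the word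
-- only by letters ≤ i + j − 2, so it creates the inverse descent i + j, which Demazure steps
-- never undo; so there is no cross in a column ≥ l either.  Hence every pipe dream for c is the
-- extension of one on the k × l grid, and extension changes neither the word nor the number of
-- crosses, while padding c by the identity does not change its length.

module Submission where

open import Defs
open import Data.Bool using (Bool; true; false; if_then_else_; _∧_)
open import Data.Bool.Properties using (T-≡)
import Data.Bool.Properties as Bool
open import Data.Empty using (⊥-elim)
open import Data.Fin using (Fin; toℕ) renaming (zero to fzero; suc to fsuc)
open import Data.Fin.Properties using (toℕ<n)
open import Data.List
  using (List; []; _∷_; _++_; map; upTo; foldl; concat; concatMap; reverse; downFrom; allFin; applyUpTo; tabulate)
open import Data.List.Membership.Propositional using (_∈_)
open import Data.List.Membership.Propositional.Properties using (∈-++⁺ʳ)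
open import Data.List.Properties
  using (map-++; upTo-∷ʳ; map-tabulate; map-upTo; reverse-map; reverse-upTo; map-cong; concatMap-cong; concatMap-++; ++-identityʳ)
open import Data.List.Relation.Unary.All using (All; []; _∷_)
open import Data.List.Relation.Unary.All.Properties using (++⁺)
open import Data.List.Relation.Unary.Any using (here)
open import Data.Maybe using (just; nothing)
open import Data.Nat using (ℕ; zero; suc; _+_; _≤_; _<_; _<ᵇ_; _≡ᵇ_; z≤n; s≤s)
open import Data.Nat.Induction using (<-rec)
open import Data.Nat.ListAction using (sum)
open import Data.Nat.ListAction.Properties using (sum-++)
open import Data.Nat.Properties
open import Data.Product using (Σ; _×_; _,_; proj₁; proj₂)
open import Data.Sum using (_⊎_; inj₁; inj₂)
import Data.Sum as Sum
open import Function using (_∘_)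
open import Function.Bundles using (Equivalence; _⇔_; mk⇔)
open import Function.Construct.Composition using (_⇔-∘_)
open import Relation.Binary.Definitions using (tri<; tri≈; tri>)
open import Relation.Binary.PropositionalEquality
open import Relation.Nullary using (¬_; yes; no)
open import Relation.Nullary.Decidable using (_×-dec_)
open import Relation.Unary using (Decidable)

<ᵇ-true : ∀ {a b} → a < b → (a <ᵇ b) ≡ true
<ᵇ-true a<b = Equivalence.to T-≡ (<⇒<ᵇ a<b)

<ᵇ-true⁻¹ : ∀ {a b} → (a <ᵇ b) ≡ true → a < b
<ᵇ-true⁻¹ {a} {b} e = <ᵇ⇒< a b (Equivalence.from T-≡ e)

<ᵇ-false : ∀ {a b} → ¬ a < b → (a <ᵇ b) ≡ false
<ᵇ-false {a} {b} a≮b with a <ᵇ b in eq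
... | false = refl
... | true  = ⊥-elim (a≮b (<ᵇ-true⁻¹ eq))

≡ᵇ-refl : ∀ a → (a ≡ᵇ a) ≡ true
≡ᵇ-refl a = Equivalence.to T-≡ (≡⇒≡ᵇ a a refl)

≡ᵇ-false : ∀ {a b} → a ≢ b → (a ≡ᵇ b) ≡ false
≡ᵇ-false {a} {b} a≢b with a ≡ᵇ b in eq
... | false = refl
... | true  = ⊥-elim (a≢b (≡ᵇ⇒≡ a b (Equivalence.from T-≡ eq)))

-- Simple transpositions

swapAt-left : ∀ p → swapAt p p ≡ suc p
swapAt-left p rewrite ≡ᵇ-refl p = refl

swapAt-right : ∀ p → swapAt p (suc p) ≡ p
swapAt-right p rewrite ≡ᵇ-false (1+n≢n {p}) | ≡ᵇ-refl p = refl

swapAt-other : ∀ p {x} → x ≢ p → x ≢ suc p → swapAt p x ≡ x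
swapAt-other p x≢p x≢1+p rewrite ≡ᵇ-false x≢p | ≡ᵇ-false x≢1+p = refl

data SwapAtView (p x : ℕ) : Set where
  left  : x ≡ p → SwapAtView p x
  right : x ≡ suc p → SwapAtView p x
  other : x ≢ p → x ≢ suc p → SwapAtView p x

swapAtView : ∀ p x → SwapAtView p x
swapAtView p x with x ≟ p | x ≟ suc p
... | yes x≡p | _        = left x≡p
... | no _    | yes x≡1+p = right x≡1+p
... | no x≢p  | no x≢1+p  = other x≢p x≢1+p

swapAt-involutive : ∀ p x → swapAt p (swapAt p x) ≡ x
swapAt-involutive p x with swapAtView p x
... | left refl  rewrite swapAt-left p  = swapAt-right p
... | right refl rewrite swapAt-right p = swapAt-left p
... | other x≢p x≢1+p rewrite swapAt-other p x≢p x≢1+p = swapAt-other p x≢p x≢1+p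

swapAt-injective : ∀ p {x y} → swapAt p x ≡ swapAt p y → x ≡ y
swapAt-injective p {x} {y} e =
  trans (sym (swapAt-involutive p x)) (trans (cong (swapAt p) e) (swapAt-involutive p y))

swapAt-< : ∀ {p m x} → suc p < m → x < m → swapAt p x < m
swapAt-< {p} {m} {x} 1+p<m x<m with swapAtView p x
... | left refl  rewrite swapAt-left p  = 1+p<m
... | right refl rewrite swapAt-right p = <-trans (n<1+n p) 1+p<m
... | other x≢p x≢1+p rewrite swapAt-other p x≢p x≢1+p = x<m

swapAt-fixes-above : ∀ p {x} → suc (suc p) ≤ x → swapAt p x ≡ x
swapAt-fixes-above p 2+p≤x =
  swapAt-other p (λ { refl → <-irrefl refl (<-trans (n<1+n p) 2+p≤x) }) (λ { refl → <-irrefl refl 2+p≤x })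

swapAt-fixes-below : ∀ p {x} → x < p → swapAt p x ≡ x
swapAt-fixes-below p x<p =
  swapAt-other p (λ { refl → <-irrefl refl x<p }) (λ { refl → <-irrefl refl (<-trans x<p (n<1+n p)) })

swapAt-mono-< : ∀ p {a b} → a < b → ¬ (a ≡ p × b ≡ suc p) → swapAt p a < swapAt p b
swapAt-mono-< p {a} {b} a<b not-pair with swapAtView p a | swapAtView p b
... | left refl  | left refl  = ⊥-elim (<-irrefl refl a<b)
... | left refl  | right refl = ⊥-elim (not-pair (refl , refl))
... | left refl  | other _ b≢1+p rewrite swapAt-left p | swapAt-other p {b} (λ { refl → <-irrefl refl a<b }) b≢1+p =
  ≤∧≢⇒< a<b (b≢1+p ∘ sym)
... | right refl | left refl  = ⊥-elim (<-asym a<b (n<1+n p))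
... | right refl | right refl = ⊥-elim (<-irrefl refl a<b)
... | right refl | other b≢p b≢1+p rewrite swapAt-right p | swapAt-other p b≢p b≢1+p = <-trans (n<1+n p) a<b
... | other a≢p a≢1+p | left refl  rewrite swapAt-left p | swapAt-other p a≢p a≢1+p = <-trans a<b (n<1+n p)
... | other a≢p a≢1+p | right refl rewrite swapAt-right p | swapAt-other p a≢p a≢1+p = ≤∧≢⇒< (≤-pred a<b) a≢p
... | other a≢p a≢1+p | other b≢p b≢1+p rewrite swapAt-other p a≢p a≢1+p | swapAt-other p b≢p b≢1+p = a<b

swapAt-<ᵇ : ∀ p a b → ¬ (a ≡ p × b ≡ suc p) → ¬ (a ≡ suc p × b ≡ p) →
            (swapAt p a <ᵇ swapAt p b) ≡ (a <ᵇ b)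
swapAt-<ᵇ p a b not-pair not-pair′ with <-cmp a b
... | tri< a<b _ _ = trans (<ᵇ-true (swapAt-mono-< p a<b not-pair)) (sym (<ᵇ-true a<b))
... | tri≈ _ refl _ = trans (<ᵇ-false {swapAt p a} (<-irrefl refl)) (sym (<ᵇ-false {a} (<-irrefl refl)))
... | tri> _ _ b<a =
  trans (<ᵇ-false (<-asym (swapAt-mono-< p b<a λ (b≡p , a≡1+p) → not-pair′ (a≡1+p , b≡p))))
        (sym (<ᵇ-false (<-asym b<a)))

sumBelow : ℕ → (ℕ → ℕ) → ℕ
sumBelow n f = sum (map f (upTo n))

sumBelow-suc : ∀ n f → sumBelow (suc n) f ≡ sumBelow n f + f n
sumBelow-suc n f = begin
  sum (map f (upTo (suc n)))        ≡⟨ cong (sum ∘ map f) (sym (upTo-∷ʳ n)) ⟩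
  sum (map f (upTo n ++ n ∷ []))    ≡⟨ cong sum (map-++ f (upTo n) (n ∷ [])) ⟩
  sum (map f (upTo n) ++ f n ∷ [])  ≡⟨ sum-++ (map f (upTo n)) (f n ∷ []) ⟩
  sumBelow n f + (f n + 0)          ≡⟨ cong (sumBelow n f +_) (+-identityʳ (f n)) ⟩
  sumBelow n f + f n                ∎
  where open ≡-Reasoning

sumBelow-cong : ∀ n {f g} → (∀ y → y < n → f y ≡ g y) → sumBelow n f ≡ sumBelow n g
sumBelow-cong zero    f≗g = refl
sumBelow-cong (suc n) {f} {g} f≗g rewrite sumBelow-suc n f | sumBelow-suc n g =
  cong₂ _+_ (sumBelow-cong n (λ y y<n → f≗g y (m<n⇒m<1+n y<n))) (f≗g n (n<1+n n))

sumBelow-mono-≤ : ∀ n {f g} → (∀ y → y < n → f y ≤ g y) → sumBelow n f ≤ sumBelow n g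
sumBelow-mono-≤ zero    f≤g = z≤n
sumBelow-mono-≤ (suc n) {f} {g} f≤g rewrite sumBelow-suc n f | sumBelow-suc n g =
  +-mono-≤ (sumBelow-mono-≤ n (λ y y<n → f≤g y (m<n⇒m<1+n y<n))) (f≤g n (n<1+n n))

sumBelow-mono-< : ∀ n {f g a} → (∀ y → y < n → f y ≤ g y) → a < n → f a < g a →
                  sumBelow n f < sumBelow n g
sumBelow-mono-< (suc n) {f} {g} {a} f≤g a<1+n fa<ga
  rewrite sumBelow-suc n f | sumBelow-suc n g with a ≟ n
... | yes refl = +-mono-≤-< (sumBelow-mono-≤ n (λ y y<n → f≤g y (m<n⇒m<1+n y<n))) fa<ga
... | no a≢n   = +-mono-<-≤ (sumBelow-mono-< n (λ y y<n → f≤g y (m<n⇒m<1+n y<n))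
                                              (≤∧≢⇒< (≤-pred a<1+n) a≢n) fa<ga)
                            (f≤g n (n<1+n n))

sumBelow-zero : ∀ n {f} → (∀ y → y < n → f y ≡ 0) → sumBelow n f ≡ 0
sumBelow-zero zero    f≗0 = refl
sumBelow-zero (suc n) {f} f≗0 rewrite sumBelow-suc n f | f≗0 n (n<1+n n) =
  trans (+-identityʳ _) (sumBelow-zero n (λ y y<n → f≗0 y (m<n⇒m<1+n y<n)))

sumBelow-extend : ∀ {n} M f → n ≤ M → (∀ y → n ≤ y → f y ≡ 0) → sumBelow M f ≡ sumBelow n f
sumBelow-extend zero    f z≤n   f≗0 = refl
sumBelow-extend (suc M) f n≤1+M f≗0 with m≤n⇒m<n∨m≡n n≤1+M
... | inj₂ refl   = refl
... | inj₁ n<1+M  rewrite sumBelow-suc M f | f≗0 M (≤-pred n<1+M) =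
  trans (+-identityʳ _) (sumBelow-extend M f (≤-pred n<1+M) f≗0)

sumBelow-swapAt : ∀ {p} n f → suc p < n → sumBelow n (f ∘ swapAt p) ≡ sumBelow n f
sumBelow-swapAt {p} (suc n) f (s≤s 1+p≤n)
  rewrite sumBelow-suc n (f ∘ swapAt p) | sumBelow-suc n f with m≤n⇒m<n∨m≡n 1+p≤n
... | inj₁ 1+p<n rewrite swapAt-fixes-above p 1+p<n = cong (_+ f n) (sumBelow-swapAt n f 1+p<n)
... | inj₂ refl
  rewrite sumBelow-suc p (f ∘ swapAt p) | sumBelow-suc p f | swapAt-left p | swapAt-right p
        | sumBelow-cong p {f ∘ swapAt p} {f} (λ y y<p → cong f (swapAt-fixes-below p y<p)) =
  trans (+-assoc (sumBelow p f) (f (suc p)) (f p))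
        (trans (cong (sumBelow p f +_) (+-comm (f (suc p)) (f p)))
               (sym (+-assoc (sumBelow p f) (f p) (f (suc p)))))

-- Inversions

indicator : Bool → ℕ
indicator b = if b then 1 else 0

indicator-mono : ∀ {x y} → (x ≡ true → y ≡ true) → indicator x ≤ indicator y
indicator-mono {false} x⇒y = z≤n
indicator-mono {true}  x⇒y rewrite x⇒y refl = ≤-refl

∧-true : ∀ {x y} → (x ∧ y) ≡ true → x ≡ true × y ≡ true
∧-true {true} {true} _ = refl , refl

inversion : (ℕ → ℕ) → ℕ → ℕ → ℕ
inversion v i j = indicator ((i <ᵇ j) ∧ (v j <ᵇ v i))

inv-∘swapAt-< : ∀ {m p} (c : ℕ → ℕ) → suc p < m → c (suc p) < c p →
                inv m (c ∘ swapAt p) < inv m c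
inv-∘swapAt-< {m} {p} c 1+p<m descent = subst (inv m u <_) (sym inv-reindexed)
  (sumBelow-mono-< m (λ i _ → sumBelow-mono-≤ m (λ j _ → pointwise i j)) 1+p<m
    (sumBelow-mono-< m (λ j _ → pointwise (suc p) j) (<-trans (n<1+n p) 1+p<m) strict))
  where
  s = swapAt p
  u = c ∘ s
  inv-reindexed : inv m c ≡ sumBelow m (λ i → sumBelow m (λ j → inversion c (s i) (s j)))
  inv-reindexed = trans (sym (sumBelow-swapAt m (λ i → sumBelow m (inversion c i)) 1+p<m))
                        (sumBelow-cong m (λ i _ → sym (sumBelow-swapAt m (inversion c (s i)) 1+p<m)))
  pointwise : ∀ i j → inversion u i j ≤ inversion c (s i) (s j)
  pointwise i j with (i ≟ p) ×-dec (j ≟ suc p) | (i ≟ suc p) ×-dec (j ≟ p)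
  ... | yes (refl , refl) | _
    rewrite swapAt-left p | swapAt-right p | <ᵇ-true (n<1+n p) | <ᵇ-false (<-asym descent) = z≤n
  ... | no _ | yes (refl , refl) rewrite <ᵇ-false (<-asym (n<1+n p)) = z≤n
  ... | no not-pair | no not-pair′ rewrite swapAt-<ᵇ p i j not-pair not-pair′ = ≤-refl
  strict : inversion u (suc p) p < inversion c (s (suc p)) (s p)
  strict rewrite swapAt-left p | swapAt-right p | <ᵇ-false (<-asym (n<1+n p))
               | <ᵇ-true (n<1+n p) | <ᵇ-true descent = s≤s z≤n

inv-swapAt∘-< : ∀ {m q a b} (c : ℕ → ℕ) → IsPerm m c → a < b → b < m →
                c a ≡ suc q → c b ≡ q → inv m (swapAt q ∘ c) < inv m c
inv-swapAt∘-< {m} {q} {a} {b} c (_ , _ , c-injective) a<b b<m ca≡1+q cb≡q =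
  sumBelow-mono-< m (λ i i<m → sumBelow-mono-≤ m (λ j j<m → pointwise i j i<m j<m)) a<m
    (sumBelow-mono-< m (λ j j<m → pointwise a j a<m j<m) b<m strict)
  where
  s = swapAt q
  u = s ∘ c
  a<m = <-trans a<b b<m
  pointwise : ∀ i j → i < m → j < m → inversion u i j ≤ inversion c i j
  pointwise i j i<m j<m with (c j ≟ q) ×-dec (c i ≟ suc q) | (c j ≟ suc q) ×-dec (c i ≟ q)
  ... | yes (cj≡q , ci≡1+q) | _ = indicator-mono λ e →
    ⊥-elim (<-asym (n<1+n q) (<ᵇ-true⁻¹ (subst₂ (λ x y → (x <ᵇ y) ≡ true)
      (trans (cong s cj≡q) (swapAt-left q)) (trans (cong s ci≡1+q) (swapAt-right q)) (proj₂ (∧-true e)))))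
  ... | no _ | yes (cj≡1+q , ci≡q) = indicator-mono λ e →
    ⊥-elim (<-asym a<b (subst₂ _<_ (c-injective i b i<m b<m (trans ci≡q (sym cb≡q)))
                                    (c-injective j a j<m a<m (trans cj≡1+q (sym ca≡1+q)))
                                    (<ᵇ-true⁻¹ (proj₁ (∧-true e)))))
  ... | no not-pair | no not-pair′ rewrite swapAt-<ᵇ q (c j) (c i) not-pair not-pair′ = ≤-refl
  strict : inversion u a b < inversion c a b
  strict rewrite ca≡1+q | cb≡q | swapAt-left q | swapAt-right q | <ᵇ-false (<-asym (n<1+n q))
               | <ᵇ-true (n<1+n q) | <ᵇ-true a<b = s≤s z≤n

inv-cong : ∀ M {u v} → u ≗ₚ v → inv M u ≡ inv M v
inv-cong M u≗v = sumBelow-cong M λ i _ → sumBelow-cong M λ j _ →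
  cong₂ (λ ui uj → indicator ((i <ᵇ j) ∧ (uj <ᵇ ui))) (u≗v i) (u≗v j)

inv-extend : ∀ {m c} M → IsPerm m c → m ≤ M → inv M c ≡ inv m c
inv-extend {m} {c} M (fixes , bounded , _) m≤M =
  trans (sumBelow-cong M (λ i _ → sumBelow-extend M (inversion c i) m≤M (right-of-block i)))
        (sumBelow-extend M _ m≤M (λ i m≤i → sumBelow-zero m (below-block i m≤i)))
  where
  right-of-block : ∀ i j → m ≤ j → inversion c i j ≡ 0
  right-of-block i j m≤j with i <? j
  ... | no i≮j rewrite <ᵇ-false i≮j = refl
  ... | yes i<j rewrite <ᵇ-true i<j | fixes j m≤j = cong indicator (<ᵇ-false ci≯j)
    where
    ci≯j : ¬ j < c i
    ci≯j j<ci with i <? m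
    ... | yes i<m = <-asym (<-≤-trans (bounded i i<m) m≤j) j<ci
    ... | no i≮m  = <-asym i<j (subst (j <_) (fixes i (≮⇒≥ i≮m)) j<ci)
  below-block : ∀ i → m ≤ i → ∀ j → j < m → inversion c i j ≡ 0
  below-block i m≤i j j<m rewrite <ᵇ-false (<-asym (<-≤-trans j<m m≤i)) = refl

-- Completions

InverseDescent : ℕ → (ℕ → ℕ) → Set
InverseDescent q v = Σ ℕ λ a → Σ ℕ λ b → a < b × v a ≡ suc q × v b ≡ q

InverseDescent-≗ : ∀ {p u v} → u ≗ₚ v → InverseDescent p u → InverseDescent p v
InverseDescent-≗ u≗v (a , b , a<b , ua , ub) = a , b , a<b , trans (sym (u≗v a)) ua , trans (sym (u≗v b)) ub

IsPerm-∘swapAt : ∀ {m p c} → suc p < m → IsPerm m c → IsPerm m (c ∘ swapAt p)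
IsPerm-∘swapAt {m} {p} {c} 1+p<m (fixes , bounded , injective) =
    (λ i m≤i → trans (cong c (swapAt-fixes-above p (≤-trans 1+p<m m≤i))) (fixes i m≤i))
  , (λ i i<m → bounded _ (swapAt-< 1+p<m i<m))
  , (λ i j i<m j<m e → swapAt-injective p (injective _ _ (swapAt-< 1+p<m i<m) (swapAt-< 1+p<m j<m) e))

IsPerm-swapAt∘ : ∀ {m q c} → suc q < m → IsPerm m c → IsPerm m (swapAt q ∘ c)
IsPerm-swapAt∘ {m} {q} {c} 1+q<m (fixes , bounded , injective) =
    (λ i m≤i → trans (cong (swapAt q) (fixes i m≤i)) (swapAt-fixes-above q (≤-trans 1+q<m m≤i)))
  , (λ i i<m → swapAt-< 1+q<m (bounded i i<m))
  , (λ i j i<m j<m e → injective i j i<m j<m (swapAt-injective q e))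

InverseDescent-bounded : ∀ {m q a b c} → IsPerm m c → a < b → c a ≡ suc q → c b ≡ q → b < m
InverseDescent-bounded {m} {q} {a} {b} {c} (fixes , bounded , _) a<b ca≡1+q cb≡q with b <? m
... | yes b<m = b<m
... | no b≮m with trans (sym (fixes b (≮⇒≥ b≮m))) cb≡q
...   | refl with a <? m
...     | yes a<m = ⊥-elim (<-asym (<-≤-trans (bounded a a<m) (≮⇒≥ b≮m)) (subst (b <_) (sym ca≡1+q) (n<1+n b)))
...     | no a≮m  = ⊥-elim (<-asym a<b (subst (b <_) (trans (sym ca≡1+q) (fixes a (≮⇒≥ a≮m))) (n<1+n b)))

≗ₚ-identityExtension : ∀ {m m′ c v} → IsPerm m c → IsPerm m′ v →
                       (∀ i → i < m → v i ≡ c i) → (∀ i → m ≤ i → i < m′ → v i ≡ i) → v ≗ₚ c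
≗ₚ-identityExtension {m} {m′} (c-fixes , _) (v-fixes , _) agree v-identity i with i <? m | i <? m′
... | yes i<m | _        = agree i i<m
... | no i≮m  | yes i<m′ = trans (v-identity i (≮⇒≥ i≮m) i<m′) (sym (c-fixes i (≮⇒≥ i≮m)))
... | no i≮m  | no i≮m′  = trans (v-fixes i (≮⇒≥ i≮m′)) (sym (c-fixes i (≮⇒≥ i≮m)))

HasNW-resp : ∀ {k l} {w : Grid k l} {m c u} →
             (∀ (i : Fin k) (j : Fin l) → (c (toℕ i) ≡ toℕ j) ⇔ (u (toℕ i) ≡ toℕ j)) →
             HasNW w m c → HasNW w m u
HasNW-resp c⇔u (k≤m , l≤m , w⇔c) = k≤m , l≤m , λ i j → c⇔u i j ⇔-∘ w⇔c i j

HasNW-∘swapAt : ∀ {k l} {w : Grid k l} {m c p} → k ≤ p → HasNW w m c → HasNW w m (c ∘ swapAt p)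
HasNW-∘swapAt {c = c} {p} k≤p = HasNW-resp {c = c} {u = c ∘ swapAt p} λ i j →
  let s-fixes = cong c (swapAt-fixes-below p (<-≤-trans (toℕ<n i) k≤p)) in
  mk⇔ (trans s-fixes) (trans (sym s-fixes))

HasNW-swapAt∘ : ∀ {k l} {w : Grid k l} {m c q} → l ≤ q → HasNW w m c → HasNW w m (swapAt q ∘ c)
HasNW-swapAt∘ {c = c} {q} l≤q = HasNW-resp {c = c} {u = swapAt q ∘ c} λ i j →
  let s-fixes = swapAt-fixes-below q (<-≤-trans (toℕ<n j) l≤q) in
  mk⇔ (λ e → trans (cong (swapAt q) e) s-fixes)
      (λ e → trans (sym (swapAt-involutive q (c (toℕ i)))) (trans (cong (swapAt q) e) s-fixes))

module _ {k l} {w : Grid k l} {m c} (completion : IsCompletion w m c) where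
  private
    perm = proj₁ completion
    nw = proj₁ (proj₂ completion)
    minimal = proj₂ (proj₂ (proj₂ completion))

  completion-ascent : ∀ {p} → k ≤ p → c p < c (suc p)
  completion-ascent {p} k≤p with <-cmp (suc p) m
  ... | tri< 1+p<m _ _ with <-cmp (c p) (c (suc p))
  ...   | tri< ascent _ _ = ascent
  ...   | tri≈ _ cp≡c1+p _ =
    ⊥-elim (1+n≢n (sym (proj₂ (proj₂ perm) p (suc p) (<-trans (n<1+n p) 1+p<m) 1+p<m cp≡c1+p)))
  ...   | tri> _ _ descent =
    ⊥-elim (<⇒≱ (inv-∘swapAt-< c 1+p<m descent)
                (minimal _ (IsPerm-∘swapAt 1+p<m perm) (HasNW-∘swapAt {c = c} k≤p nw)))
  completion-ascent {p} k≤p | tri≈ _ 1+p≡m _ rewrite proj₁ perm (suc p) (≤-reflexive (sym 1+p≡m)) =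
    subst (c p <_) (sym 1+p≡m) (proj₁ (proj₂ perm) p (subst (p <_) 1+p≡m (n<1+n p)))
  completion-ascent {p} k≤p | tri> _ _ m<1+p
    rewrite proj₁ perm (suc p) (<⇒≤ m<1+p) | proj₁ perm p (≤-pred m<1+p) = n<1+n p

  completion-no-inverseDescent : ∀ {q} → l ≤ q → ¬ InverseDescent q c
  completion-no-inverseDescent {q} l≤q (a , b , a<b , ca≡1+q , cb≡q) =
    <⇒≱ (inv-swapAt∘-< c perm a<b b<m ca≡1+q cb≡q)
        (minimal _ (IsPerm-swapAt∘ 1+q<m perm) (HasNW-swapAt∘ {c = c} l≤q nw))
    where
    b<m = InverseDescent-bounded perm a<b ca≡1+q cb≡q
    1+q<m = subst (_< m) ca≡1+q (proj₁ (proj₂ perm) a (<-trans a<b b<m))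

-- Demazure products

demStep-ascent : ∀ u p → u p < u (suc p) → ∀ x → demStep u p x ≡ u (swapAt p x)
demStep-ascent u p ascent x rewrite <ᵇ-true ascent = refl

demStep-nonascent : ∀ u p → ¬ u p < u (suc p) → ∀ x → demStep u p x ≡ u x
demStep-nonascent u p ¬ascent x rewrite <ᵇ-false ¬ascent = refl

demStep-nonascent-at : ∀ u p → ¬ demStep u p p < demStep u p (suc p)
demStep-nonascent-at u p with u p <? u (suc p)
... | yes ascent = λ lt → <-asym ascent (subst₂ _<_
        (trans (demStep-ascent u p ascent p) (cong u (swapAt-left p)))
        (trans (demStep-ascent u p ascent (suc p)) (cong u (swapAt-right p))) lt)
... | no ¬ascent = λ lt → ¬ascent (subst₂ _<_
        (demStep-nonascent u p ¬ascent p) (demStep-nonascent u p ¬ascent (suc p)) lt)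

data LastAtLeast (k : ℕ) : List ℕ → Set where
  last : ∀ {x} → k ≤ x → LastAtLeast k (x ∷ [])
  cons : ∀ x {L} → LastAtLeast k L → LastAtLeast k (x ∷ L)

LastAtLeast-∈ : ∀ {k x xs} → All (k ≤_) xs → x ∈ xs → LastAtLeast k xs
LastAtLeast-∈ (k≤y ∷ all) _ = nonempty k≤y all
  where
  nonempty : ∀ {k y ys} → k ≤ y → All (k ≤_) ys → LastAtLeast k (y ∷ ys)
  nonempty k≤y []            = last k≤y
  nonempty _   (k≤z ∷ all) = cons _ (nonempty k≤z all)

LastAtLeast-++ʳ : ∀ {k} xs {ys} → LastAtLeast k ys → LastAtLeast k (xs ++ ys)
LastAtLeast-++ʳ []       l = l
LastAtLeast-++ʳ (x ∷ xs) l = cons x (LastAtLeast-++ʳ xs l)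

LastAtLeast-++ˡ : ∀ {k xs ys} → LastAtLeast k xs → All (k ≤_) ys → LastAtLeast k (xs ++ ys)
LastAtLeast-++ˡ (last k≤x) []          = last k≤x
LastAtLeast-++ˡ (last _)   all@(_ ∷ _) = cons _ (LastAtLeast-∈ all (here refl))
LastAtLeast-++ˡ (cons x l) all         = cons x (LastAtLeast-++ˡ l all)

foldl-demStep-nonascent : ∀ {k L} → LastAtLeast k L → ∀ u →
  Σ ℕ λ q → k ≤ q × ¬ foldl demStep u L q < foldl demStep u L (suc q)
foldl-demStep-nonascent (last {x} k≤x) u = x , k≤x , demStep-nonascent-at u x
foldl-demStep-nonascent (cons x l)     u = foldl-demStep-nonascent l (demStep u x)

data ClearUntil (p : ℕ) : List ℕ → Set where
  reached : ∀ {L} → ClearUntil p (p ∷ L)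
  skip    : ∀ {x L} → 2 + x ≤ p → ClearUntil p L → ClearUntil p (x ∷ L)

ClearUntil-++ˡ : ∀ {p xs ys} → ClearUntil p xs → ClearUntil p (xs ++ ys)
ClearUntil-++ˡ reached       = reached
ClearUntil-++ˡ (skip x≪p cl) = skip x≪p (ClearUntil-++ˡ cl)

ClearUntil-++ʳ : ∀ {p xs ys} → All (λ x → 2 + x ≤ p) xs → ClearUntil p ys → ClearUntil p (xs ++ ys)
ClearUntil-++ʳ []            cl = cl
ClearUntil-++ʳ (x≪p ∷ all) cl = skip x≪p (ClearUntil-++ʳ all cl)

InverseDescent-demStep : ∀ {p u} → InverseDescent p u → ∀ q → InverseDescent p (demStep u q)
InverseDescent-demStep {p} {u} (a , b , a<b , ua≡1+p , ub≡p) q with u q <? u (suc q)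
... | no ¬ascent = a , b , a<b , trans (demStep-nonascent u q ¬ascent a) ua≡1+p
                               , trans (demStep-nonascent u q ¬ascent b) ub≡p
... | yes ascent = swapAt q a , swapAt q b , swapAt-mono-< q a<b not-swapped
                 , trans (demStep-ascent u q ascent _) (trans (cong u (swapAt-involutive q a)) ua≡1+p)
                 , trans (demStep-ascent u q ascent _) (trans (cong u (swapAt-involutive q b)) ub≡p)
  where
  -- a step swaps only an ascent, and (a , b) is a descent
  not-swapped : ¬ (a ≡ q × b ≡ suc q)
  not-swapped (refl , refl) = <-asym (n<1+n p) (subst₂ _<_ ua≡1+p ub≡p ascent)

InverseDescent-foldl : ∀ {p u} → InverseDescent p u → ∀ L → InverseDescent p (foldl demStep u L)
InverseDescent-foldl d []      = d
InverseDescent-foldl d (q ∷ L) = InverseDescent-foldl (InverseDescent-demStep d q) L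

foldl-demStep-inverseDescent : ∀ {p L} → ClearUntil p L → ∀ u → (∀ x → p ≤ x → u x ≡ x) →
                               InverseDescent p (foldl demStep u L)
foldl-demStep-inverseDescent {p} (reached {L}) u fixes = InverseDescent-foldl created L
  where
  ascent : u p < u (suc p)
  ascent = subst₂ _<_ (sym (fixes p ≤-refl)) (sym (fixes (suc p) (n≤1+n p))) (n<1+n p)
  created : InverseDescent p (demStep u p)
  created = p , suc p , n<1+n p
          , trans (demStep-ascent u p ascent p) (trans (cong u (swapAt-left p)) (fixes (suc p) (n≤1+n p)))
          , trans (demStep-ascent u p ascent (suc p)) (trans (cong u (swapAt-right p)) (fixes p ≤-refl))
foldl-demStep-inverseDescent {p} (skip {x} x≪p cl) u fixes = foldl-demStep-inverseDescent cl (demStep u x) fixes′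
  where
  fixes′ : ∀ y → p ≤ y → demStep u x y ≡ y
  fixes′ y p≤y with u x <? u (suc x)
  ... | yes ascent = trans (demStep-ascent u x ascent y)
                           (trans (cong u (swapAt-fixes-above x (≤-trans x≪p p≤y))) (fixes y p≤y))
  ... | no ¬ascent = trans (demStep-nonascent u x ¬ascent y) (fixes y p≤y)

toFin?-< : ∀ n i → i < n → Σ (Fin n) λ a → toFin? n i ≡ just a × toℕ a ≡ i
toFin?-< (suc n) zero    _     = fzero , refl , refl
toFin?-< (suc n) (suc i) 1+i<n with toFin?-< n i (≤-pred 1+i<n)
... | a , e , refl rewrite e = fsuc a , refl , refl

toFin?-≥ : ∀ n i → n ≤ i → toFin? n i ≡ nothing
toFin?-≥ zero    i       _     = refl
toFin?-≥ (suc n) (suc i) 1+n≤i rewrite toFin?-≥ n i (≤-pred 1+n≤i) = refl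

toFin?-toℕ : ∀ n (a : Fin n) → toFin? n (toℕ a) ≡ just a
toFin?-toℕ (suc n) fzero    = refl
toFin?-toℕ (suc n) (fsuc a) rewrite toFin?-toℕ n a = refl

entry-just : ∀ {k l} (P : Grid k l) {i j a b} → toFin? k i ≡ just a → toFin? l j ≡ just b → entry P i j ≡ P a b
entry-just {k} {l} P {i} {j} ei ej with toFin? k i | toFin? l j
entry-just P refl refl | just a | just b = refl

entry-toℕ : ∀ {k l} (P : Grid k l) a b → entry P (toℕ a) (toℕ b) ≡ P a b
entry-toℕ {k} {l} P a b = entry-just P (toFin?-toℕ k a) (toFin?-toℕ l b)

entry-outside : ∀ {k l} (P : Grid k l) {i j} → k ≤ i ⊎ l ≤ j → entry P i j ≡ false
entry-outside {k} {l} P {i} {j} out with toFin? k i in ei | toFin? l j in ej | out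
... | nothing | _       | _         = refl
... | just _  | nothing | _         = refl
... | just _  | just _  | inj₁ k≤i with () ← trans (sym ei) (toFin?-≥ k i k≤i)
... | just _  | just _  | inj₂ l≤j with () ← trans (sym ej) (toFin?-≥ l j l≤j)

data Cell (k l i j : ℕ) : Set where
  inside  : (a : Fin k) (b : Fin l) → toℕ a ≡ i → toℕ b ≡ j → Cell k l i j
  outside : k ≤ i ⊎ l ≤ j → Cell k l i j

cell : ∀ k l i j → Cell k l i j
cell k l i j with i <? k | j <? l
... | no i≮k | _      = outside (inj₁ (≮⇒≥ i≮k))
... | yes _  | no j≮l = outside (inj₂ (≮⇒≥ j≮l))
... | yes i<k | yes j<l with toFin?-< k i i<k | toFin?-< l j j<l
...   | a , _ , a≡i | b , _ , b≡j = inside a b a≡i b≡j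

entry-true⇒inside : ∀ {k l} (P : Grid k l) {i j} → entry P i j ≡ true → i < k × j < l
entry-true⇒inside {k} {l} P {i} {j} e with cell k l i j
... | inside a b refl refl = toℕ<n a , toℕ<n b
... | outside out with () ← trans (sym e) (entry-outside P out)

entry-cong : ∀ {k l} {P Q : Grid k l} → P ≗ᵍ Q → ∀ i j → entry P i j ≡ entry Q i j
entry-cong {k} {l} {P} {Q} P≗Q i j with cell k l i j
... | inside a b refl refl = trans (entry-toℕ P a b) (trans (P≗Q a b) (sym (entry-toℕ Q a b)))
... | outside out          = trans (entry-outside P out) (sym (entry-outside Q out))

entry-ext : ∀ {k l} M (P : Grid k l) → k ≤ M → l ≤ M → ∀ i j → entry (ext M P) i j ≡ entry P i j
entry-ext {k} {l} M P k≤M l≤M i j with cell M M i j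
... | inside a b refl refl = entry-toℕ (ext M P) a b
... | outside out          = trans (entry-outside (ext M P) out)
                                   (sym (entry-outside P (Sum.map (≤-trans k≤M) (≤-trans l≤M) out)))

ext-injective : ∀ {k l} M {P Q : Grid k l} → k ≤ M → l ≤ M → ext M P ≗ᵍ ext M Q → P ≗ᵍ Q
ext-injective M {P} {Q} k≤M l≤M extP≗extQ a b = begin
  P a b                            ≡⟨ sym (entry-toℕ P a b) ⟩
  entry P (toℕ a) (toℕ b)          ≡⟨ sym (entry-ext M P k≤M l≤M _ _) ⟩
  entry (ext M P) (toℕ a) (toℕ b)  ≡⟨ entry-cong extP≗extQ _ _ ⟩
  entry (ext M Q) (toℕ a) (toℕ b)  ≡⟨ entry-ext M Q k≤M l≤M _ _ ⟩
  entry Q (toℕ a) (toℕ b)          ≡⟨ entry-toℕ Q a b ⟩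
  Q a b                            ∎
  where open ≡-Reasoning

restrict : ∀ k l {M} → Grid M M → Grid k l
restrict k l Q a b = entry Q (toℕ a) (toℕ b)

ext-restrict : ∀ {k l M} (Q : Grid M M) → (∀ i j → entry Q i j ≡ true → i < k × j < l) →
               ext M (restrict k l Q) ≗ᵍ Q
ext-restrict {k} {l} Q support a b = trans (entry-restrict (toℕ a) (toℕ b)) (entry-toℕ Q a b)
  where
  entry-restrict : ∀ i j → entry (restrict k l Q) i j ≡ entry Q i j
  entry-restrict i j with cell k l i j
  ... | inside a b refl refl = entry-toℕ (restrict k l Q) a b
  ... | outside out with entry Q i j in eij
  ...   | false = entry-outside (restrict k l Q) out
  ...   | true with support i j eij | out
  ...     | i<k , _ | inj₁ k≤i = ⊥-elim (<⇒≱ i<k k≤i)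
  ...     | _ , j<l | inj₂ l≤j = ⊥-elim (<⇒≱ j<l l≤j)

-- Words and cross counts

map-allFin : ∀ {B : Set} n (g : ℕ → B) → map (g ∘ toℕ) (allFin n) ≡ map g (upTo n)
map-allFin n g = trans (map-tabulate (λ a → a) (g ∘ toℕ)) (trans (tabulate-toℕ n g) (sym (map-upTo g n)))
  where
  tabulate-toℕ : ∀ {B : Set} n (g : ℕ → B) → tabulate {n = n} (g ∘ toℕ) ≡ applyUpTo g n
  tabulate-toℕ zero    g = refl
  tabulate-toℕ (suc n) g = cong (g 0 ∷_) (tabulate-toℕ n (g ∘ suc))

concatMap-upTo-suc : ∀ {B : Set} (F : ℕ → List B) n → concatMap F (upTo (suc n)) ≡ concatMap F (upTo n) ++ F n
concatMap-upTo-suc F n = begin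
  concatMap F (upTo (suc n))            ≡⟨ cong (concatMap F) (sym (upTo-∷ʳ n)) ⟩
  concatMap F (upTo n ++ n ∷ [])        ≡⟨ concatMap-++ F (upTo n) (n ∷ []) ⟩
  concatMap F (upTo n) ++ (F n ++ [])   ≡⟨ cong (concatMap F (upTo n) ++_) (++-identityʳ (F n)) ⟩
  concatMap F (upTo n) ++ F n           ∎
  where open ≡-Reasoning

concatMap-upTo-extend : ∀ {B : Set} (F : ℕ → List B) {r} R → r ≤ R → (∀ y → r ≤ y → F y ≡ []) →
                        concatMap F (upTo R) ≡ concatMap F (upTo r)
concatMap-upTo-extend F zero    z≤n   F≗[] = refl
concatMap-upTo-extend F (suc R) r≤1+R F≗[] with m≤n⇒m<n∨m≡n r≤1+R
... | inj₂ refl  = refl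
... | inj₁ r<1+R rewrite concatMap-upTo-suc F R | F≗[] R (≤-pred r<1+R) =
  trans (++-identityʳ _) (concatMap-upTo-extend F R (≤-pred r<1+R) F≗[])

rowWord : (ℕ → ℕ → Bool) → ℕ → ℕ → List ℕ
rowWord E s i = concatMap (λ j → if E i j then (i + j) ∷ [] else []) (downFrom s)

gridWord : ℕ → ℕ → (ℕ → ℕ → Bool) → List ℕ
gridWord r s E = concatMap (rowWord E s) (upTo r)

word≡gridWord : ∀ {k l} (P : Grid k l) → word P ≡ gridWord k l (entry P)
word≡gridWord {k} {l} P =
  trans (concatMap-cong row≡rowWord (allFin k)) (cong concat (map-allFin k (rowWord (entry P) l)))
  where
  letter : ℕ → ℕ → List ℕ
  letter i j = if entry P i j then (i + j) ∷ [] else []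
  row≡rowWord : ∀ a → concatMap (λ b → if P a b then (toℕ a + toℕ b) ∷ [] else []) (reverse (allFin l))
                    ≡ rowWord (entry P) l (toℕ a)
  row≡rowWord a = begin
    concatMap (λ b → if P a b then (toℕ a + toℕ b) ∷ [] else []) (reverse (allFin l))
      ≡⟨ concatMap-cong (λ b → cong (λ x → if x then (toℕ a + toℕ b) ∷ [] else []) (sym (entry-toℕ P a b)))
                        (reverse (allFin l)) ⟩
    concat (map (letter (toℕ a) ∘ toℕ) (reverse (allFin l)))
      ≡⟨ cong concat (reverse-map (letter (toℕ a) ∘ toℕ) (allFin l)) ⟩
    concat (reverse (map (letter (toℕ a) ∘ toℕ) (allFin l)))
      ≡⟨ cong (concat ∘ reverse) (map-allFin l (letter (toℕ a))) ⟩
    concat (reverse (map (letter (toℕ a)) (upTo l)))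
      ≡⟨ cong concat (sym (reverse-map (letter (toℕ a)) (upTo l))) ⟩
    concat (map (letter (toℕ a)) (reverse (upTo l)))
      ≡⟨ cong (concatMap (letter (toℕ a))) (reverse-upTo l) ⟩
    rowWord (entry P) l (toℕ a) ∎
    where open ≡-Reasoning

gridWord-cong : ∀ r s {E E′ : ℕ → ℕ → Bool} → (∀ i j → E i j ≡ E′ i j) → gridWord r s E ≡ gridWord r s E′
gridWord-cong r s E≗E′ = concatMap-cong (λ i → concatMap-cong
  (λ j → cong (λ x → if x then (i + j) ∷ [] else []) (E≗E′ i j)) (downFrom s)) (upTo r)

rowWord-extend : ∀ E i {s} S → s ≤ S → (∀ j → s ≤ j → E i j ≡ false) → rowWord E S i ≡ rowWord E s i
rowWord-extend E i zero    z≤n   off = refl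
rowWord-extend E i (suc S) s≤1+S off with m≤n⇒m<n∨m≡n s≤1+S
... | inj₂ refl  = refl
... | inj₁ s<1+S rewrite off S (≤-pred s<1+S) = rowWord-extend E i S (≤-pred s<1+S) off

gridWord-extend : ∀ E {r s} M → r ≤ M → s ≤ M → (∀ i j → r ≤ i ⊎ s ≤ j → E i j ≡ false) →
                  gridWord M M E ≡ gridWord r s E
gridWord-extend E {r} {s} M r≤M s≤M off =
  trans (concatMap-cong (λ i → rowWord-extend E i M s≤M (λ j s≤j → off i j (inj₂ s≤j))) (upTo M))
        (concatMap-upTo-extend (rowWord E s) M r≤M
          (λ i r≤i → rowWord-extend E i s z≤n (λ j _ → off i j (inj₁ r≤i))))

word-ext : ∀ {k l} M (P : Grid k l) → k ≤ M → l ≤ M → word (ext M P) ≡ word P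
word-ext {k} {l} M P k≤M l≤M = begin
  word (ext M P)               ≡⟨ word≡gridWord (ext M P) ⟩
  gridWord M M (entry (ext M P)) ≡⟨ gridWord-cong M M (entry-ext M P k≤M l≤M) ⟩
  gridWord M M (entry P)       ≡⟨ gridWord-extend (entry P) M k≤M l≤M (λ i j → entry-outside P) ⟩
  gridWord k l (entry P)       ≡⟨ sym (word≡gridWord P) ⟩
  word P                       ∎
  where open ≡-Reasoning

word-cong : ∀ {k l} {P Q : Grid k l} → P ≗ᵍ Q → word P ≡ word Q
word-cong {k} {l} {P} {Q} P≗Q =
  trans (word≡gridWord P) (trans (gridWord-cong k l (entry-cong P≗Q)) (sym (word≡gridWord Q)))

gridCrosses : ℕ → ℕ → (ℕ → ℕ → Bool) → ℕ
gridCrosses r s E = sumBelow r (λ i → sumBelow s (λ j → indicator (E i j)))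

crosses≡gridCrosses : ∀ {k l} (P : Grid k l) → crosses P ≡ gridCrosses k l (entry P)
crosses≡gridCrosses {k} {l} P =
  trans (cong sum (map-cong row≡ (allFin k))) (cong sum (map-allFin k (λ i → sumBelow l (λ j → indicator (entry P i j)))))
  where
  row≡ : ∀ a → sum (map (λ b → indicator (P a b)) (allFin l)) ≡ sumBelow l (λ j → indicator (entry P (toℕ a) j))
  row≡ a = trans (cong sum (map-cong (λ b → cong indicator (sym (entry-toℕ P a b))) (allFin l)))
                 (cong sum (map-allFin l (λ j → indicator (entry P (toℕ a) j))))

gridCrosses-cong : ∀ r s {E E′ : ℕ → ℕ → Bool} → (∀ i j → E i j ≡ E′ i j) → gridCrosses r s E ≡ gridCrosses r s E′
gridCrosses-cong r s E≗E′ = sumBelow-cong r (λ i _ → sumBelow-cong s (λ j _ → cong indicator (E≗E′ i j)))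

gridCrosses-extend : ∀ E {r s} M → r ≤ M → s ≤ M → (∀ i j → r ≤ i ⊎ s ≤ j → E i j ≡ false) →
                     gridCrosses M M E ≡ gridCrosses r s E
gridCrosses-extend E {r} {s} M r≤M s≤M off =
  trans (sumBelow-cong M (λ i _ → sumBelow-extend M _ s≤M (λ j s≤j → cong indicator (off i j (inj₂ s≤j)))))
        (sumBelow-extend M _ r≤M (λ i r≤i → sumBelow-zero s (λ j _ → cong indicator (off i j (inj₁ r≤i)))))

crosses-ext : ∀ {k l} M (P : Grid k l) → k ≤ M → l ≤ M → crosses (ext M P) ≡ crosses P
crosses-ext {k} {l} M P k≤M l≤M = begin
  crosses (ext M P)                 ≡⟨ crosses≡gridCrosses (ext M P) ⟩
  gridCrosses M M (entry (ext M P)) ≡⟨ gridCrosses-cong M M (entry-ext M P k≤M l≤M) ⟩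
  gridCrosses M M (entry P)         ≡⟨ gridCrosses-extend (entry P) M k≤M l≤M (λ i j → entry-outside P) ⟩
  gridCrosses k l (entry P)         ≡⟨ sym (crosses≡gridCrosses P) ⟩
  crosses P                         ∎
  where open ≡-Reasoning

crosses-cong : ∀ {k l} {P Q : Grid k l} → P ≗ᵍ Q → crosses P ≡ crosses Q
crosses-cong {k} {l} {P} {Q} P≗Q =
  trans (crosses≡gridCrosses P) (trans (gridCrosses-cong k l (entry-cong P≗Q)) (sym (crosses≡gridCrosses Q)))

δ≡foldl-gridWord : ∀ {k l} (P : Grid k l) → δ P ≡ foldl demStep (λ x → x) (gridWord k l (entry P))
δ≡foldl-gridWord P = cong (foldl demStep (λ x → x)) (word≡gridWord P)

δ-ext : ∀ {k l} M (P : Grid k l) → k ≤ M → l ≤ M → δ (ext M P) ≡ δ P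
δ-ext M P k≤M l≤M = cong (foldl demStep (λ x → x)) (word-ext M P k≤M l≤M)

δ-cong : ∀ {k l} {P Q : Grid k l} → P ≗ᵍ Q → δ P ≡ δ Q
δ-cong P≗Q = cong (foldl demStep (λ x → x)) (word-cong P≗Q)

module _ {P : ℕ → Set} (P? : Decidable P) where

  private
    below-top : ∀ {n t} → ¬ P n → t < suc n → P t → t < n
    below-top ¬Pn t<1+n Pt = ≤∧≢⇒< (≤-pred t<1+n) λ { refl → ¬Pn Pt }

  greatest : ∀ {n t} → t < n → P t → Σ ℕ λ g → g < n × P g × (∀ {t′} → t′ < n → P t′ → t′ ≤ g)
  greatest {suc n} t<1+n Pt with P? n
  ... | yes Pn = n , n<1+n n , Pn , λ t′<1+n _ → ≤-pred t′<1+n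
  ... | no ¬Pn with greatest (below-top ¬Pn t<1+n Pt) Pt
  ...   | g , g<n , Pg , maximal =
    g , m<n⇒m<1+n g<n , Pg , λ t′<1+n Pt′ → maximal (below-top ¬Pn t′<1+n Pt′) Pt′

  LeastWitness≤ : ℕ → Set
  LeastWitness≤ t = Σ ℕ λ g → g ≤ t × P g × (∀ {t′} → t′ < g → ¬ P t′)

  least : ∀ {t} → P t → LeastWitness≤ t
  least {t} = <-rec (λ t → P t → LeastWitness≤ t) step t
    where
    step : ∀ t → (∀ {t′} → t′ < t → P t′ → LeastWitness≤ t′) → P t → LeastWitness≤ t
    step t smaller Pt with anyUpTo? P? t
    ... | no none = t , ≤-refl , Pt , λ t′<t Pt′ → none (_ , t′<t , Pt′)
    ... | yes (t′ , t′<t , Pt′) with smaller t′<t Pt′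
    ...   | g , g≤t′ , Pg , minimal = g , ≤-trans g≤t′ (<⇒≤ t′<t) , Pg , minimal

-- Where the crosses of a pipe dream can lie

gridWord-LastAtLeast : ∀ {r s} E {i j} → i < r → j < s → E i j ≡ true → LastAtLeast i (gridWord r s E)
gridWord-LastAtLeast {r} {s} E {i} {j} i<r j<s eij = rows r i<r
  where
  row-≥ : ∀ {y} → i ≤ y → ∀ n → All (i ≤_) (rowWord E n y)
  row-≥ i≤y zero = []
  row-≥ {y} i≤y (suc n) with E y n
  ... | true  = ≤-trans i≤y (m≤m+n y n) ∷ row-≥ i≤y n
  ... | false = row-≥ i≤y n
  row-∋ : ∀ n → j < n → i + j ∈ rowWord E n i
  row-∋ (suc n) j<1+n with n ≟ j
  ... | yes refl rewrite eij = here refl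
  ... | no n≢j = ∈-++⁺ʳ (if E i n then (i + n) ∷ [] else []) (row-∋ n (≤∧≢⇒< (≤-pred j<1+n) (n≢j ∘ sym)))
  rows : ∀ n → i < n → LastAtLeast i (concatMap (rowWord E s) (upTo n))
  rows (suc n) i<1+n rewrite concatMap-upTo-suc (rowWord E s) n with n ≟ i
  ... | yes refl = LastAtLeast-++ʳ (concatMap (rowWord E s) (upTo n)) (LastAtLeast-∈ (row-≥ ≤-refl s) (row-∋ s j<s))
  ... | no n≢i = LastAtLeast-++ˡ (rows n (≤∧≢⇒< (≤-pred i<1+n) (n≢i ∘ sym))) (row-≥ (≤-pred i<1+n) s)

gridWord-ClearUntil-corner :
  ∀ {r s} E {i₁ j₁} → i₁ < r → j₁ < s → E i₁ j₁ ≡ true →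
  (∀ {i j} → i < r → j < s → E i j ≡ true → j ≤ j₁) → (∀ {i} → i < i₁ → E i j₁ ≢ true) →
  ClearUntil (i₁ + j₁) (gridWord r s E)
gridWord-ClearUntil-corner {r} {s} E {i₁} {j₁} i₁<r j₁<s corner rightmost topmost = rows r i₁<r
  where
  p = i₁ + j₁
  row-above : ∀ {y} → y < i₁ → ∀ n → n ≤ s → All (λ x → 2 + x ≤ p) (rowWord E n y)
  row-above y<i₁ zero _ = []
  row-above {y} y<i₁ (suc n) 1+n≤s with E y n in eyn
  ... | false = row-above y<i₁ n (<⇒≤ 1+n≤s)
  ... | true  = subst (_≤ p) (cong suc (+-suc y n)) (+-mono-≤ y<i₁ n<j₁) ∷ row-above y<i₁ n (<⇒≤ 1+n≤s)
    where
    n<j₁ : n < j₁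
    n<j₁ = ≤∧≢⇒< (rightmost (<-trans y<i₁ i₁<r) 1+n≤s eyn) λ { refl → topmost y<i₁ eyn }
  rows-above : ∀ n → n ≤ i₁ → All (λ x → 2 + x ≤ p) (concatMap (rowWord E s) (upTo n))
  rows-above zero    _      = []
  rows-above (suc n) 1+n≤i₁ rewrite concatMap-upTo-suc (rowWord E s) n =
    ++⁺ (rows-above n (<⇒≤ 1+n≤i₁)) (row-above 1+n≤i₁ s ≤-refl)
  corner-row : ∀ n → j₁ < n → n ≤ s → ClearUntil p (rowWord E n i₁)
  corner-row (suc n) j₁<1+n 1+n≤s with n ≟ j₁
  ... | yes refl rewrite corner = reached
  ... | no n≢j₁ with E i₁ n in ein
  ...   | true  = ⊥-elim (n≢j₁ (≤-antisym (rightmost i₁<r 1+n≤s ein) (≤-pred j₁<1+n)))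
  ...   | false = corner-row n (≤∧≢⇒< (≤-pred j₁<1+n) (n≢j₁ ∘ sym)) (<⇒≤ 1+n≤s)
  rows : ∀ n → i₁ < n → ClearUntil p (concatMap (rowWord E s) (upTo n))
  rows (suc n) i₁<1+n rewrite concatMap-upTo-suc (rowWord E s) n with n ≟ i₁
  ... | yes refl = ClearUntil-++ʳ (rows-above n ≤-refl) (corner-row s j₁<s ≤-refl)
  ... | no n≢i₁  = ClearUntil-++ˡ (rows n (≤∧≢⇒< (≤-pred i₁<1+n) (n≢i₁ ∘ sym)))

gridWord-ClearUntil : ∀ {r s} E {i j} → i < r → j < s → E i j ≡ true →
                      Σ ℕ λ p → j ≤ p × ClearUntil p (gridWord r s E)
gridWord-ClearUntil {r} {s} E {i} {j} i<r j<s eij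
  with greatest (λ j′ → anyUpTo? (λ i′ → E i′ j′ Bool.≟ true) r) j<s (i , i<r , eij)
... | j₁ , j₁<s , (i₀ , i₀<r , ei₀j₁) , rightmost with least (λ i′ → E i′ j₁ Bool.≟ true) ei₀j₁
...   | i₁ , i₁≤i₀ , ei₁j₁ , topmost =
  i₁ + j₁ , ≤-trans (rightmost j<s (i , i<r , eij)) (m≤n+m j₁ i₁) ,
  gridWord-ClearUntil-corner E (≤-<-trans i₁≤i₀ i₀<r) j₁<s ei₁j₁
    (λ i<r j<s e → rightmost j<s (_ , i<r , e)) topmost

crosses-inside : ∀ {r s k l} (Q : Grid r s) →
                 (∀ {p} → k ≤ p → δ Q p < δ Q (suc p)) → (∀ {q} → l ≤ q → ¬ InverseDescent q (δ Q)) →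
                 ∀ i j → entry Q i j ≡ true → i < k × j < l
crosses-inside {k = k} {l} Q ascents no-inverseDescents i j eij with k ≤? i | l ≤? j
... | yes k≤i | _
  with foldl-demStep-nonascent (gridWord-LastAtLeast (entry Q) (proj₁ (entry-true⇒inside Q eij))
                                                               (proj₂ (entry-true⇒inside Q eij)) eij) (λ x → x)
...   | q , i≤q , ¬ascent =
  ⊥-elim (¬ascent (subst (λ f → f q < f (suc q)) (δ≡foldl-gridWord Q) (ascents (≤-trans k≤i i≤q))))
crosses-inside {k = k} {l} Q ascents no-inverseDescents i j eij | no _ | yes l≤j
  with gridWord-ClearUntil (entry Q) (proj₁ (entry-true⇒inside Q eij)) (proj₂ (entry-true⇒inside Q eij)) eij
...   | p , j≤p , clear =
  ⊥-elim (no-inverseDescents (≤-trans l≤j j≤p)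
           (subst (InverseDescent p) (sym (δ≡foldl-gridWord Q))
                  (foldl-demStep-inverseDescent clear (λ x → x) (λ _ _ → refl))))
crosses-inside Q _ _ i j eij | no k≰i | no l≰j = ≰⇒> k≰i , ≰⇒> l≰j

-- Extension by elbows for a completion

module _ {k l} {w : Grid k l} {m c} (completion : IsCompletion w m c) {M v} (m≤M : m ≤ M) (v≗c : v ≗ₚ c) where
  private
    k≤M = ≤-trans (proj₁ (proj₁ (proj₂ completion))) m≤M
    l≤M = ≤-trans (proj₁ (proj₂ (proj₁ (proj₂ completion)))) m≤M

    support : ∀ (Q : Grid M M) → δ Q ≗ₚ v → ∀ i j → entry Q i j ≡ true → i < k × j < l
    support Q δQ≗v = crosses-inside Q
      (λ k≤p → subst₂ _<_ (sym (δQ≗c _)) (sym (δQ≗c _)) (completion-ascent completion k≤p))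
      (λ l≤q d → completion-no-inverseDescent completion l≤q (InverseDescent-≗ δQ≗c d))
      where
      δQ≗c : δ Q ≗ₚ c
      δQ≗c x = trans (δQ≗v x) (v≗c x)

    inv-M : inv M v ≡ inv m c
    inv-M = trans (inv-cong M v≗c) (inv-extend M (proj₁ completion) m≤M)

  ext-Pipes : ExtBij M (PipesW w m c) (Pipes M v)
  ext-Pipes = forward , (λ _ _ _ _ → ext-injective M k≤M l≤M) , backward
    where
    forward : ∀ P → PipesW w m c P → Pipes M v (ext M P)
    forward P δP≗c x = trans (cong (λ f → f x) (δ-ext M P k≤M l≤M)) (trans (δP≗c x) (sym (v≗c x)))
    backward : ∀ Q → Pipes M v Q → Σ (Grid k l) λ P → PipesW w m c P × ext M P ≗ᵍ Q
    backward Q δQ≗v = restrict k l Q , δ-restrict , ext-restrict Q (support Q δQ≗v)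
      where
      δ-restrict : δ (restrict k l Q) ≗ₚ c
      δ-restrict x = begin
        δ (restrict k l Q) x           ≡⟨ cong (λ f → f x) (sym (δ-ext M (restrict k l Q) k≤M l≤M)) ⟩
        δ (ext M (restrict k l Q)) x   ≡⟨ cong (λ f → f x) (δ-cong (ext-restrict Q (support Q δQ≗v))) ⟩
        δ Q x                          ≡⟨ δQ≗v x ⟩
        v x                            ≡⟨ v≗c x ⟩
        c x                            ∎
        where open ≡-Reasoning

  ext-RPipes : ExtBij M (RPipesW w m c) (RPipes M v)
  ext-RPipes = forward , (λ _ _ _ _ → ext-injective M k≤M l≤M) , backward
    where
    forward : ∀ P → RPipesW w m c P → RPipes M v (ext M P)
    forward P (δP≗c , #P) = proj₁ ext-Pipes P δP≗c , trans (crosses-ext M P k≤M l≤M) (trans #P (sym inv-M))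
    backward : ∀ Q → RPipes M v Q → Σ (Grid k l) λ P → RPipesW w m c P × ext M P ≗ᵍ Q
    backward Q (δQ≗v , #Q) with proj₂ (proj₂ ext-Pipes) Q δQ≗v
    ... | P , δP≗c , extP≗Q = P , (δP≗c , #P) , extP≗Q
      where
      #P : crosses P ≡ inv m c
      #P = begin
        crosses P          ≡⟨ sym (crosses-ext M P k≤M l≤M) ⟩
        crosses (ext M P)  ≡⟨ crosses-cong extP≗Q ⟩
        crosses Q          ≡⟨ #Q ⟩
        inv M v            ≡⟨ inv-M ⟩
        inv m c            ∎
        where open ≡-Reasoning

lemma2p4 : ∀ {k l} (w : Grid k l) → IsPPM w →
    ∀ (m : ℕ) (c : ℕ → ℕ) → IsCompletion w m c →
      ExtBij m (RPipesW w m c) (RPipes m c)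
      × ExtBij m (PipesW w m c) (Pipes m c)
      × (∀ (m′ : ℕ) (v : ℕ → ℕ) → m ≤ m′ → IsPerm m′ v →
           (∀ i → i < m → v i ≡ c i) → (∀ i → m ≤ i → i < m′ → v i ≡ i) →
           ExtBij m′ (RPipesW w m c) (RPipes m′ v)
           × ExtBij m′ (PipesW w m c) (Pipes m′ v))
-- IsPPM w only matters for the existence of the completion, which is assumed.
lemma2p4 w _ m c completion =
    ext-RPipes completion ≤-refl (λ _ → refl)
  , ext-Pipes completion ≤-refl (λ _ → refl)
  , λ m′ v m≤m′ v-perm agree v-identity →
      let v≗c = ≗ₚ-identityExtension (proj₁ completion) v-perm agree v-identity
      in ext-RPipes completion m≤m′ v≗c , ext-Pipes completion m≤m′ v≗c
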